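{- Let $k\ge 4$ be an integer, let $G$ be a $k$-critical graph, and let $(T,\mathcal W)$ be a standard tree-decomposition of $G$, $\mathcal W=(W_t:t\in V(T))$. Then (i) if $t_0,t_1$ are adjacent in $T$, the two vertices of $W_{t_0}\cap W_{t_1}$ are not adjacent in $G$; and (ii) if $t_1,t_2$ are distinct neighbors of $t_0$ in $T$, then $W_{t_0}\cap W_{t_1}\ne W_{t_0}\cap W_{t_2}$.
   Context: All graphs are finite and simple. A graph $G$ is $k$-critical if $G$ is not $(k-1)$-colorable but every proper subgraph is. A tree decomposition of $G$ is a pair $(T,\mathcal W)$ with $T$ a tree and $\mathcal W=(W_t:t\in V(T))$ subsets of $V(G)$ such that $\bigcup_t W_t=V(G)$, every edge of $G$ has both ends in some $W_t$, and $W_t\cap W_{t''}\subseteq W_{t'}$ whenever $t'$ lies on the path of $T$ between $t$ and $t''$. The torso at $t$ is the graph with vertex set $W_t$ in which $u,v$ are adjacent iff they are adjacent in $G$ or $u,v\in W_{t'}$ for some neighbor $t'$ of $t$ in $T$. The tree-decomposition is standard if $|W_t\cap W_{t'}|=2$ for every edge $tt'\in E(T)$ and every torso is $3$-connected or a cycle. A graph is $3$-connected if it has at least $4$ vertices and remains connected after deleting any at most $2$ vertices. -}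

module Defs where

open import Data.Nat using (ℕ; zero; suc; _≤_; _∸_)
open import Data.Fin using (Fin; toℕ)
open import Data.Bool using (Bool; true; _∧_)
open import Data.List using (List; []; _∷_)
open import Data.List.Membership.Propositional using (_∈_)
open import Data.List.Relation.Unary.Unique.Propositional using (Unique)
open import Data.Product using (Σ; ∃; ∃-syntax; _×_; _,_; proj₁)
open import Data.Sum using (_⊎_)
open import Data.Unit using (⊤)
open import Data.Empty using (⊥)
open import Relation.Nullary using (¬_)
open import Relation.Binary.PropositionalEquality using (_≡_; _≢_)
open import Function.Bundles using (_⇔_)

data IsWalk {V : Set} (Adj : V → V → Set) : V → V → List V → Set where
  single : ∀ {v} → IsWalk Adj v v (v ∷ [])
  cons   : ∀ {u w v xs} → Adj u w → IsWalk Adj w v xs → IsWalk Adj u v (u ∷ xs)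

IsPath : {V : Set} → (V → V → Set) → V → V → List V → Set
IsPath Adj u v xs = IsWalk Adj u v xs × Unique xs

Restrict : {V : Set} → (V → V → Set) → (V → Set) → V → V → Set
Restrict Adj P a b = Adj a b × P a × P b

ConnectedOn : {V : Set} → (V → V → Set) → (V → Set) → Set
ConnectedOn {V} Adj P = (u v : V) → P u → P v → ∃[ xs ] IsWalk (Restrict Adj P) u v xs

Connected : {V : Set} → (V → V → Set) → Set
Connected Adj = ConnectedOn Adj (λ _ → ⊤)

-- 3-connected: at least 4 vertices, and connected after deleting any at most 2
-- vertices (deleting a and b; a ≡ b covers deleting one vertex; plus deleting none).
ThreeConnected : {V : Set} → (V → V → Set) → Set
ThreeConnected {V} Adj =
  (Σ V λ a → Σ V λ b → Σ V λ c → Σ V λ d →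
     a ≢ b × a ≢ c × a ≢ d × b ≢ c × b ≢ d × c ≢ d)
  × Connected Adj
  × ((a b : V) → ConnectedOn Adj (λ v → v ≢ a × v ≢ b))

Consec : (c : ℕ) → Fin c → Fin c → Set
Consec c i j = toℕ j ≡ suc (toℕ i) ⊎ (toℕ i ≡ c ∸ 1 × toℕ j ≡ 0)

IsCycle : {V : Set} → (V → V → Set) → Set
IsCycle {V} Adj =
  Σ ℕ λ c → 3 ≤ c × Σ (Fin c → V) λ f →
    ((i j : Fin c) → f i ≡ f j → i ≡ j)
    × ((v : V) → ∃[ i ] f i ≡ v)
    × ((i j : Fin c) → Adj (f i) (f j) ⇔ (Consec c i j ⊎ Consec c j i))

record Graph (n : ℕ) : Set₁ where
  field
    Adj    : Fin n → Fin n → Set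
    sym    : ∀ {u v} → Adj u v → Adj v u
    irrefl : ∀ {v} → ¬ Adj v v
open Graph public

record Subgraph {n : ℕ} (G : Graph n) : Set₁ where
  field
    VP   : Fin n → Set
    EP   : Fin n → Fin n → Set
    EPsym : ∀ {u v} → EP u v → EP v u
    EP⊆  : ∀ {u v} → EP u v → Adj G u v
    ends : ∀ {u v} → EP u v → VP u × VP v
open Subgraph public

Proper : {n : ℕ} {G : Graph n} → Subgraph G → Set
Proper {n} {G} H = (∃[ v ] ¬ VP H v) ⊎ (∃[ u ] ∃[ v ] (Adj G u v × ¬ EP H u v))

-- proper colouring with c colours of the graph with edge relation E
-- (colours of vertices outside the subgraph are irrelevant)
ColorableE : {n : ℕ} → ℕ → (Fin n → Fin n → Set) → Set
ColorableE {n} c E = Σ (Fin n → Fin c) λ col → ∀ u v → E u v → col u ≢ col v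

Colorable : {n : ℕ} → ℕ → Graph n → Set
Colorable c G = ColorableE c (Adj G)

SubColorable : {n : ℕ} {G : Graph n} → ℕ → Subgraph G → Set
SubColorable c H = ColorableE c (EP H)

Critical : {n : ℕ} → ℕ → Graph n → Set₁
Critical k G = ¬ Colorable (k ∸ 1) G × ((H : Subgraph G) → Proper H → SubColorable (k ∸ 1) H)

record Tree (m : ℕ) : Set₁ where
  field
    graph   : Graph m
    path    : ∀ s t → ∃[ xs ] IsPath (Adj graph) s t xs
    uniqueP : ∀ s t xs ys → IsPath (Adj graph) s t xs → IsPath (Adj graph) s t ys → xs ≡ ys
open Tree public

TAdj : {m : ℕ} → Tree m → Fin m → Fin m → Set
TAdj T = Adj (graph T)

InBag : {m n : ℕ} → (Fin m → Fin n → Bool) → Fin m → Fin n → Set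
InBag W t v = W t v ≡ true

record IsTreeDecomposition {n m : ℕ} (G : Graph n) (T : Tree m)
                           (W : Fin m → Fin n → Bool) : Set where
  field
    cover  : ∀ v → ∃[ t ] InBag W t v
    edges  : ∀ u v → Adj G u v → ∃[ t ] (InBag W t u × InBag W t v)
    interp : ∀ t t' t'' xs → IsPath (TAdj T) t t'' xs → t' ∈ xs →
             ∀ v → InBag W t v → InBag W t'' v → InBag W t' v

TorsoV : {m n : ℕ} → (Fin m → Fin n → Bool) → Fin m → Set
TorsoV W t = Σ _ (InBag W t)

TorsoAdj : {n m : ℕ} (G : Graph n) (T : Tree m) (W : Fin m → Fin n → Bool) (t : Fin m) →
           TorsoV W t → TorsoV W t → Set
TorsoAdj G T W t x y =
  proj₁ x ≢ proj₁ y ×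
  (Adj G (proj₁ x) (proj₁ y) ⊎
   ∃[ t' ] (TAdj T t t' × InBag W t' (proj₁ x) × InBag W t' (proj₁ y)))

record IsStandard {n m : ℕ} (G : Graph n) (T : Tree m)
                  (W : Fin m → Fin n → Bool) : Set where
  field
    treeDec  : IsTreeDecomposition G T W
    adhesion : ∀ t t' → TAdj T t t' →
               Σ (Fin n) λ a → Σ (Fin n) λ b → a ≢ b ×
                 (∀ v → (InBag W t v × InBag W t' v) ⇔ (v ≡ a ⊎ v ≡ b))
    torsos   : ∀ t → ThreeConnected (TorsoAdj G T W t) ⊎ IsCycle (TorsoAdj G T W t)

module Submission where

-- Fix a node t₀ of T.  Every other node t lies in the branch of T - t₀ entered
-- by the unique path from t₀ to t.  Routes from t₀ into different branches meet
-- only at t₀, so together they form the path between their ends; hence a vertex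
-- of G in bags of two different branches lies in W_{t₀} and in the bag of the
-- first node of the branch (Rooted.junction, cross-branch).  Consequently, if S is
-- a union of branches whose adhesions with t₀ lie in {a, b}, the bags in S and
-- those outside S span two parts of G covering every edge and meeting only in
-- {a, b} (module Decomposition).  Every bag of a standard decomposition has three
-- vertices, so each part misses a vertex and is (k-1)-colourable by criticality.
-- Colourings of the two parts that agree on whether a and b receive the same
-- colour glue, after permuting colours, to a (k-1)-colouring of G (glue), which
-- is impossible.  For (i), an edge ab forces both colourings to separate a and b.
-- For (ii), colour the parts "branch t₁ or t₂", "not branch t₂" and "not branch
-- t₁": two of the three colourings agree on a, b and they cover one of two
-- separations of G.

open import Defs
open import Data.Nat using (ℕ; _∸_; _≤_; s≤s)
import Data.Nat as ℕ
open import Data.Fin using (Fin; zero; suc)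
open import Data.Fin.Properties using (_≟_; any?; 0≢1+n; suc-injective)
open import Data.Fin.Permutation.Components using (transpose; transpose-inverse)
open import Data.Bool using (Bool; true; _∧_)
import Data.Bool.Properties as Bool
open import Data.Maybe using (Maybe; just)
import Data.Maybe.Properties as Maybe
open import Data.Product using (Σ; ∃-syntax; _×_; _,_; proj₁; proj₂; uncurry)
open import Data.Sum using (_⊎_; inj₁; inj₂; [_,_]′)
open import Data.Empty using (⊥; ⊥-elim)
open import Data.List using (List; []; _∷_; _++_; drop; head; reverse)
open import Data.List.Properties using (unfold-reverse)
open import Data.List.Membership.Propositional using (_∈_; _∉_)
open import Data.List.Membership.Propositional.Properties using (∈-++⁺ˡ)
open import Data.List.Relation.Unary.Any using (here; there)
import Data.List.Relation.Unary.Any.Properties as Any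
open import Data.List.Relation.Unary.All using ([])
open import Data.List.Relation.Unary.All.Properties using (¬Any⇒All¬)
open import Data.List.Relation.Unary.AllPairs using ([]; _∷_)
open import Data.List.Relation.Unary.Unique.Propositional using (Unique)
open import Data.List.Relation.Unary.Unique.Propositional.Properties
  using (++⁺; drop⁺; Unique[x∷xs]⇒x∉xs)
open import Data.List.Relation.Binary.Disjoint.Propositional using (Disjoint)
import Data.List.Relation.Binary.Subset.Propositional as List
open import Data.List.Relation.Binary.Permutation.Propositional using (↭-sym; ↭⇒↭ₛ′)
open import Data.List.Relation.Binary.Permutation.Propositional.Properties using (↭-reverse)
import Data.List.Relation.Binary.Permutation.Setoid.Properties as Permutation
open import Relation.Nullary using (¬_; Dec; yes; no)
open import Relation.Nullary.Decidable using (_×-dec_; dec-true; dec-false)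
open import Level using (0ℓ)
open import Relation.Unary using (Pred; Decidable; ∁; _∪_; _⊆_)
open import Relation.Unary.Properties using (_∪?_)
open import Relation.Binary.Definitions using (Symmetric; DecidableEquality)
open import Relation.Binary.PropositionalEquality using (_≡_; _≢_; refl; cong; trans; module ≡-Reasoning)
import Relation.Binary.PropositionalEquality as ≡
open import Axiom.UniquenessOfIdentityProofs using (module Decidable⇒UIP)
open import Function.Base using (_∘_; const)
open import Function.Bundles using (_⇔_; mk⇔; Equivalence)
open import Function.Properties.Equivalence using () renaming (sym to ⇔-sym)

unique-reverse : {A : Set} {xs : List A} → Unique xs → Unique (reverse xs)
unique-reverse {A} {xs} =
  Permutation.Unique-resp-↭ (≡.setoid A) (↭⇒↭ₛ′ ≡.isEquivalence (↭-sym (↭-reverse xs)))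

second-∈ : {A : Set} {s : A} (xs : List A) → head (drop 1 xs) ≡ just s → s ∈ xs
second-∈ (_ ∷ _ ∷ _) refl = there (here refl)

⇔-both-true : {P Q : Set} → P → Q → P ⇔ Q
⇔-both-true p q = mk⇔ (const q) (const p)

⇔-both-false : {P Q : Set} → ¬ P → ¬ Q → P ⇔ Q
⇔-both-false ¬p ¬q = mk⇔ (⊥-elim ∘ ¬p) (⊥-elim ∘ ¬q)

two-of-three : {P Q R : Set} → Dec P → Dec Q → Dec R → (P ⇔ Q) ⊎ (P ⇔ R) ⊎ (Q ⇔ R)
two-of-three (yes p) (yes q) _       = inj₁ (⇔-both-true p q)
two-of-three (no ¬p) (no ¬q) _       = inj₁ (⇔-both-false ¬p ¬q)
two-of-three (yes p) (no _)  (yes r) = inj₂ (inj₁ (⇔-both-true p r))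
two-of-three (yes _) (no ¬q) (no ¬r) = inj₂ (inj₂ (⇔-both-false ¬q ¬r))
two-of-three (no ¬p) (yes _) (no ¬r) = inj₂ (inj₁ (⇔-both-false ¬p ¬r))
two-of-three (no _)  (yes q) (yes r) = inj₂ (inj₂ (⇔-both-true q r))

one-differs : {A : Set} → DecidableEquality A → {y z : A} → y ≢ z → ∀ c → y ≢ c ⊎ z ≢ c
one-differs _≟ᴬ_ {y} y≢z c with y ≟ᴬ c
... | yes refl = inj₂ (y≢z ∘ ≡.sym)
... | no y≢c   = inj₁ y≢c

avoid-two : {A : Set} → DecidableEquality A → {P : A → Set} {x y z : A} →
            P x → P y → P z → x ≢ y → x ≢ z → y ≢ z →
            (a b : A) → ∃[ w ] P w × w ≢ a × w ≢ b
avoid-two _≟ᴬ_ {x = x} {y} {z} px py pz x≢y x≢z y≢z a b with x ≟ᴬ a | x ≟ᴬ b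
... | no x≢a | no x≢b = x , px , x≢a , x≢b
... | yes refl | _ = [ (λ y≢b → y , py , x≢y ∘ ≡.sym , y≢b)
                     , (λ z≢b → z , pz , x≢z ∘ ≡.sym , z≢b) ]′ (one-differs _≟ᴬ_ y≢z b)
... | _ | yes refl = [ (λ y≢a → y , py , y≢a , x≢y ∘ ≡.sym)
                     , (λ z≢a → z , pz , z≢a , x≢z ∘ ≡.sym) ]′ (one-differs _≟ᴬ_ y≢z a)

three-vertices : {V : Set} {A : V → V → Set} → ThreeConnected A ⊎ IsCycle A →
                 Σ V λ x → Σ V λ y → Σ V λ z → x ≢ y × x ≢ z × y ≢ z
three-vertices (inj₁ ((x , y , z , _ , x≢y , x≢z , _ , y≢z , _) , _)) = x , y , z , x≢y , x≢z , y≢z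
three-vertices (inj₂ (ℕ.suc (ℕ.suc (ℕ.suc _)) , s≤s (s≤s (s≤s _)) , f , f-inj , _)) =
  f zero , f (suc zero) , f (suc (suc zero)) ,
  0≢1+n ∘ f-inj _ _ , 0≢1+n ∘ f-inj _ _ , 0≢1+n ∘ suc-injective ∘ f-inj _ _

relabel : {c : ℕ} (α β α' β' : Fin c) → (α ≡ β ⇔ α' ≡ β') →
          Σ (Fin c → Fin c) λ π → (∀ {x y} → π x ≡ π y → x ≡ y) × π α ≡ α' × π β ≡ β'
relabel α β α' β' same = π , π-injective , πα , πβ
  where
    transpose-injective : ∀ i j {x y} → transpose i j x ≡ transpose i j y → x ≡ y
    transpose-injective i j {x} {y} eq = begin
      x                                   ≡⟨ transpose-inverse j i ⟨
      transpose j i (transpose i j x)     ≡⟨ cong (transpose j i) eq ⟩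
      transpose j i (transpose i j y)     ≡⟨ transpose-inverse j i ⟩
      y                                   ∎
      where open ≡-Reasoning

    transpose-source : ∀ i j → transpose i j i ≡ j
    transpose-source i j rewrite dec-true (i ≟ i) refl = refl

    transpose-fixes : ∀ i j k → k ≢ i → k ≢ j → transpose i j k ≡ k
    transpose-fixes i j k k≢i k≢j rewrite dec-false (k ≟ i) k≢i | dec-false (k ≟ j) k≢j = refl

    σ τ π : Fin _ → Fin _
    σ = transpose α α'
    τ = transpose (σ β) β'
    π x = τ (σ x)

    π-injective : ∀ {x y} → π x ≡ π y → x ≡ y
    π-injective = transpose-injective α α' ∘ transpose-injective (σ β) β'

    πβ : π β ≡ β'
    πβ = transpose-source (σ β) β'

    πα : π α ≡ α'
    πα with α' ≟ β'
    ... | yes α'≡β' = trans (cong π (Equivalence.from same α'≡β')) (trans πβ (≡.sym α'≡β'))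
    ... | no α'≢β' = trans (cong τ (transpose-source α α')) (transpose-fixes (σ β) β' α' α'≢σβ α'≢β')
      where
        α'≢σβ : α' ≢ σ β
        α'≢σβ eq = α'≢β' (Equivalence.to same
          (transpose-injective α α' (trans (transpose-source α α') eq)))

module Walks {V : Set} {A : V → V → Set} where

  walk-start : ∀ {u v xs} → IsWalk A u v xs → xs ≡ u ∷ drop 1 xs
  walk-start single     = refl
  walk-start (cons _ _) = refl

  walk-++ : ∀ {u w v xs ys} → IsWalk A u w xs → IsWalk A w v ys → IsWalk A u v (xs ++ drop 1 ys)
  walk-++ single single     = single
  walk-++ single (cons a q) = cons a q
  walk-++ (cons a p) q      = cons a (walk-++ p q)

  walk-reverse : Symmetric A → ∀ {u v xs} → IsWalk A u v xs → IsWalk A v u (reverse xs)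
  walk-reverse A-sym single = single
  walk-reverse A-sym {xs = u ∷ xs} (cons a p) rewrite unfold-reverse u xs =
    walk-++ (walk-reverse A-sym p) (cons (A-sym a) single)

  path-cons : ∀ {u w v xs} → A u w → IsPath A w v xs → u ∉ xs → IsPath A u v (u ∷ xs)
  path-cons a (p , distinct) u∉ = cons a p , ¬Any⇒All¬ _ u∉ ∷ distinct

  path-prefix : ∀ {u v s xs} → IsPath A u v xs → s ∈ xs →
                ∃[ ys ] IsPath A u s ys × ys List.⊆ xs
  path-prefix (single , _) (here refl) = _ , (single , [] ∷ []) , λ s∈ → s∈
  path-prefix (cons _ _ , _) (here refl) = _ , (single , [] ∷ []) , λ { (here refl) → here refl }
  path-prefix (cons a p , distinct@(_ ∷ distinct')) (there s∈) with path-prefix (p , distinct') s∈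
  ... | ys , q , ys⊆ =
    _ ∷ ys , path-cons a q (Unique[x∷xs]⇒x∉xs distinct ∘ ys⊆) ,
    λ { (here refl) → here refl ; (there y∈) → there (ys⊆ y∈) }

module Rooted {m : ℕ} (T : Tree m) (t₀ : Fin m) where
  open Walks

  route : Fin m → List (Fin m)
  route t = proj₁ (path T t₀ t)

  route-path : ∀ t → IsPath (TAdj T) t₀ t (route t)
  route-path t = proj₂ (path T t₀ t)

  -- the neighbour of t₀ by which the route to t leaves t₀ (nothing for t = t₀)
  firstStep : Fin m → Maybe (Fin m)
  firstStep t = head (drop 1 (route t))

  -- t lies in the component of T - t₀ containing the neighbour s
  Branch : Fin m → Pred (Fin m) 0ℓ
  Branch s t = firstStep t ≡ just s

  branch? : ∀ s → Decidable (Branch s)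
  branch? s t = Maybe.≡-dec _≟_ (firstStep t) (just s)

  firstStep-path : ∀ {t p} → IsPath (TAdj T) t₀ t p → firstStep t ≡ head (drop 1 p)
  firstStep-path {t} P = cong (head ∘ drop 1) (uniqueP T t₀ t _ _ (route-path t) P)

  branch-of-neighbour : ∀ {s} → TAdj T t₀ s → Branch s s
  branch-of-neighbour t₀s =
    firstStep-path (path-cons t₀s (single , [] ∷ []) λ { (here refl) → irrefl (graph T) t₀s })

  root-in-no-branch : ∀ {s} → ¬ Branch s t₀
  root-in-no-branch B with trans (≡.sym (firstStep-path (single , [] ∷ []))) B
  ... | ()

  root-on-route : ∀ t → t₀ ∈ route t
  root-on-route t = ≡.subst (t₀ ∈_) (≡.sym (walk-start (proj₁ (route-path t)))) (here refl)

  step-on-route : ∀ {s t} → Branch s t → s ∈ route t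
  step-on-route {t = t} = second-∈ (route t)

  beyond-root : ∀ {t s p} → IsPath (TAdj T) t₀ t p → s ∈ drop 1 p →
                s ≢ t₀ × firstStep s ≡ head (drop 1 p)
  beyond-root (cons {w = t₁} {xs = p'} a rest , distinct@(_ ∷ distinct')) s∈
    with path-prefix (rest , distinct') s∈
  ... | ys , P , ys⊆ = (λ { refl → t₀∉ s∈ }) , (begin
        firstStep _   ≡⟨ firstStep-path (path-cons a P (t₀∉ ∘ ys⊆)) ⟩
        head ys       ≡⟨ cong head (walk-start (proj₁ P)) ⟩
        just t₁       ≡⟨ cong head (walk-start rest) ⟨
        head p'       ∎)
    where
      open ≡-Reasoning
      t₀∉ : t₀ ∉ p'
      t₀∉ = Unique[x∷xs]⇒x∉xs distinct

  on-path : ∀ {t s p} → IsPath (TAdj T) t₀ t p → s ∈ p → s ≡ t₀ ⊎ firstStep s ≡ head (drop 1 p)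
  on-path (single , _)     (here refl) = inj₁ refl
  on-path (cons _ _ , _)   (here refl) = inj₁ refl
  on-path P@(cons _ _ , _) (there s∈)  = inj₂ (proj₂ (beyond-root P s∈))

  -- Routes into different branches meet only at t₀, so they join to the path from t to t'.
  junction : ∀ {t t'} → firstStep t ≢ firstStep t' →
             IsPath (TAdj T) t t' (reverse (route t) ++ drop 1 (route t'))
  junction {t} {t'} different =
      walk-++ (walk-reverse (sym (graph T)) (proj₁ (route-path t))) (proj₁ (route-path t'))
    , ++⁺ (unique-reverse (proj₂ (route-path t))) (drop⁺ 1 (proj₂ (route-path t'))) disjoint
    where
      disjoint : Disjoint (reverse (route t)) (drop 1 (route t'))
      disjoint (s∈t , s∈t') with beyond-root (route-path t') s∈t'
                                 | on-path (route-path t) (Any.reverse⁻ s∈t)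
      ... | s≢t₀ , _     | inj₁ s≡t₀ = s≢t₀ s≡t₀
      ... | _    , same' | inj₂ same = different (trans (≡.sym same) same')

module Colouring {n : ℕ} (G : Graph n) where

  ProperOn : {c : ℕ} → (Fin n → Fin c) → Pred (Fin n) 0ℓ → Set
  ProperOn col Q = ∀ u v → Adj G u v → Q u → Q v → col u ≢ col v

  proper-mono : ∀ {c} {col : Fin n → Fin c} {Q Q' : Pred (Fin n) 0ℓ} →
                Q' ⊆ Q → ProperOn col Q → ProperOn col Q'
  proper-mono Q'⊆Q proper u v e q'u q'v = proper u v e (Q'⊆Q q'u) (Q'⊆Q q'v)

  induced : Pred (Fin n) 0ℓ → Subgraph G
  induced Q = record
    { VP = Q ; EP = λ u v → Adj G u v × Q u × Q v
    ; EPsym = λ { (e , qu , qv) → sym G e , qv , qu } ; EP⊆ = proj₁ ; ends = proj₂ }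

  record Separation (X Y : Pred (Fin n) 0ℓ) (a b : Fin n) : Set where
    field
      X?     : Decidable X
      covers : ∀ u v → Adj G u v → (X u × X v) ⊎ (Y u × Y v)
      meet   : ∀ {x} → X x → Y x → x ≡ a ⊎ x ≡ b

  -- Colourings of the two sides of a separation that agree on whether a, b
  -- share a colour combine into a colouring of G: keep the colouring of X and
  -- relabel the colouring of Y so that it matches on a and b.
  glue : ∀ {c X Y a b} {colX colY : Fin n → Fin c} → Separation X Y a b →
         ProperOn colX X → ProperOn colY Y → (colX a ≡ colX b ⇔ colY a ≡ colY b) →
         Colorable c G
  glue {c} {X} {Y} {a} {b} {colX} {colY} sep properX properY agree = colour , proper
    where
      open Separation sep
      relabelling : Σ (Fin c → Fin c) λ π →
                    (∀ {x y} → π x ≡ π y → x ≡ y) × π (colY a) ≡ colX a × π (colY b) ≡ colX b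
      relabelling = relabel (colY a) (colY b) (colX a) (colX b) (⇔-sym agree)

      π : Fin c → Fin c
      π = proj₁ relabelling

      π-injective : ∀ {x y} → π x ≡ π y → x ≡ y
      π-injective = proj₁ (proj₂ relabelling)

      π-meet : ∀ {x} → X x → Y x → π (colY x) ≡ colX x
      π-meet xx yx with meet xx yx
      ... | inj₁ refl = proj₁ (proj₂ (proj₂ relabelling))
      ... | inj₂ refl = proj₂ (proj₂ (proj₂ relabelling))

      colour : Fin n → Fin c
      colour x with X? x
      ... | yes _ = colX x
      ... | no _  = π (colY x)

      in-Y : ∀ {u v} → Adj G u v → ¬ X v → Y u × Y v
      in-Y {u} {v} e ¬xv with covers u v e
      ... | inj₁ (_ , xv) = ⊥-elim (¬xv xv)
      ... | inj₂ yuv = yuv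

      mixed : ∀ {u v} → Adj G u v → X u → ¬ X v → colX u ≢ π (colY v)
      mixed {u} {v} e xu ¬xv eq with in-Y e ¬xv
      ... | yu , yv = properY u v e yu yv (π-injective (trans (π-meet xu yu) eq))

      proper : ∀ u v → Adj G u v → colour u ≢ colour v
      proper u v e with X? u | X? v
      ... | yes xu | yes xv = properX u v e xu xv
      ... | yes xu | no ¬xv = mixed e xu ¬xv
      ... | no ¬xu | yes xv = mixed (sym G e) xv ¬xu ∘ ≡.sym
      ... | no ¬xu | no ¬xv = properY u v e (proj₂ (in-Y (sym G e) ¬xu)) (proj₂ (in-Y e ¬xv)) ∘ π-injective

module CriticalGraph {k n : ℕ} {G : Graph n} (crit : Critical k G) where
  open Colouring G

  ColouringOf : Pred (Fin n) 0ℓ → Set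
  ColouringOf Q = Σ (Fin n → Fin (k ∸ 1)) λ col → ProperOn col Q

  -- a vertex set missing some vertex induces a proper subgraph, hence is (k-1)-colourable
  colour-missing : ∀ {w} (Q : Pred (Fin n) 0ℓ) → ¬ Q w → ColouringOf Q
  colour-missing Q ¬Qw with proj₂ crit (induced Q) (inj₁ (_ , ¬Qw))
  ... | col , proper = col , λ u v e qu qv → proper u v (e , qu , qv)

  incompatible : ∀ {X Y a b} {colX colY : Fin n → Fin (k ∸ 1)} → Separation X Y a b →
                 ProperOn colX X → ProperOn colY Y → ¬ (colX a ≡ colX b ⇔ colY a ≡ colY b)
  incompatible sep properX properY agree = proj₁ crit (glue sep properX properY agree)

module Decomposition {n m : ℕ} (G : Graph n) (T : Tree m) (W : Fin m → Fin n → Bool)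
                     (td : IsTreeDecomposition G T W) where
  open IsTreeDecomposition td
  open Colouring G using (Separation)

  Piece : Pred (Fin m) 0ℓ → Pred (Fin n) 0ℓ
  Piece S x = ∃[ t ] S t × InBag W t x

  piece? : ∀ {S} → Decidable S → Decidable (Piece S)
  piece? S? x = any? (λ t → S? t ×-dec (W t x Bool.≟ true))

  piece-mono : ∀ {S S'} → S ⊆ S' → Piece S ⊆ Piece S'
  piece-mono S⊆S' (t , St , xt) = t , S⊆S' St , xt

  SharedWithin : Fin m → Fin m → Fin n → Fin n → Set
  SharedWithin t t' a b = ∀ {x} → InBag W t x → InBag W t' x → x ≡ a ⊎ x ≡ b

  Separates : Pred (Fin m) 0ℓ → Fin n → Fin n → Set
  Separates S a b = ∀ {t t'} → S t → ¬ S t' → SharedWithin t t' a b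

  separates-∪ : ∀ {S S' a b} → Separates S a b → Separates S' a b → Separates (S ∪ S') a b
  separates-∪ sep sep' (inj₁ St)  ¬SS't' = sep St (¬SS't' ∘ inj₁)
  separates-∪ sep sep' (inj₂ S't) ¬SS't' = sep' S't (¬SS't' ∘ inj₂)

  piece-separation : ∀ {S a b} → Decidable S → Separates S a b →
                     Separation (Piece S) (Piece (∁ S)) a b
  piece-separation {S} {a} {b} S? sep = record { X? = piece? S? ; covers = covers ; meet = meet }
    where
      covers : ∀ u v → Adj G u v → (Piece S u × Piece S v) ⊎ (Piece (∁ S) u × Piece (∁ S) v)
      covers u v e with edges u v e
      ... | t , ut , vt with S? t
      ...   | yes St = inj₁ ((t , St , ut) , (t , St , vt))
      ...   | no ¬St = inj₂ ((t , ¬St , ut) , (t , ¬St , vt))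
      meet : ∀ {x} → Piece S x → Piece (∁ S) x → x ≡ a ⊎ x ≡ b
      meet (_ , St , xt) (_ , ¬St' , xt') = sep St ¬St' xt xt'

  cross-branch : ∀ t₀ {s t t' x} → Rooted.Branch T t₀ s t → ¬ Rooted.Branch T t₀ s t' →
                 InBag W t x → InBag W t' x → InBag W t₀ x × InBag W s x
  cross-branch t₀ {s} {t} {t'} {x} Bt ¬Bt' xt xt' = along (root-on-route t) , along (step-on-route Bt)
    where
      open Rooted T t₀
      along : ∀ {r} → r ∈ route t → InBag W r x
      along r∈ = interp t _ t' _ (junction (λ eq → ¬Bt' (trans (≡.sym eq) Bt)))
                        (∈-++⁺ˡ (Any.reverse⁺ r∈)) x xt xt'

  branch-separates : ∀ t₀ {s a b} → SharedWithin t₀ s a b → Separates (Rooted.Branch T t₀ s) a b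
  branch-separates t₀ within Bt ¬Bt' xt xt' = uncurry within (cross-branch t₀ Bt ¬Bt' xt xt')

module StandardCritical {k n m : ℕ} {G : Graph n} (crit : Critical k G)
                        {T : Tree m} {W : Fin m → Fin n → Bool} (std : IsStandard G T W) where
  open IsStandard std
  open Colouring G
  open CriticalGraph {k = k} crit
  open Decomposition G T W treeDec

  torso-vertex-≡ : ∀ {t} {p q : TorsoV W t} → proj₁ p ≡ proj₁ q → p ≡ q
  torso-vertex-≡ {p = v , i} {q = .v , j} refl = cong (v ,_) (Decidable⇒UIP.≡-irrelevant Bool._≟_ i j)

  -- every bag has a vertex other than a and b, since its torso has three vertices
  bag-avoids : ∀ t a b → ∃[ w ] InBag W t w × w ≢ a × w ≢ b
  bag-avoids t a b with three-vertices (torsos t)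
  ... | x , y , z , x≢y , x≢z , y≢z =
    avoid-two _≟_ (proj₂ x) (proj₂ y) (proj₂ z)
              (x≢y ∘ torso-vertex-≡) (x≢z ∘ torso-vertex-≡) (y≢z ∘ torso-vertex-≡) a b

  -- the part spanned by S misses a vertex of a bag outside S, so it is colourable
  colour-piece : ∀ {S a b t} → Separates S a b → ¬ S t →
                 ColouringOf (Piece S)
  colour-piece {S} {a} {b} {t} sep ¬St with bag-avoids t a b
  ... | w , wt , w≢a , w≢b =
    colour-missing (Piece S) λ { (_ , St' , wt') → [ w≢a , w≢b ]′ (sep St' ¬St wt' wt) }

  colour-co-piece : ∀ {S a b t} → Separates S a b → S t →
                    ColouringOf (Piece (∁ S))
  colour-co-piece {S} {a} {b} {t} sep St with bag-avoids t a b
  ... | w , wt , w≢a , w≢b =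
    colour-missing (Piece (∁ S)) λ { (_ , ¬St' , wt') → [ w≢a , w≢b ]′ (sep St ¬St' wt wt') }

  adhesion-pair : ∀ {t t'} → TAdj T t t' → Σ (Fin n) λ a → Σ (Fin n) λ b →
                  SharedWithin t t' a b × (InBag W t a × InBag W t' a) × (InBag W t b × InBag W t' b)
  adhesion-pair {t} {t'} tt' with adhesion t t' tt'
  ... | a , b , _ , shared =
    a , b , (λ xt xt' → Equivalence.to (shared _) (xt , xt')) ,
    Equivalence.from (shared a) (inj₁ refl) , Equivalence.from (shared b) (inj₂ refl)

  separator-nonadjacent : ∀ {t₀ t₁ a b} → TAdj T t₀ t₁ → SharedWithin t₀ t₁ a b →
                          InBag W t₀ a × InBag W t₁ a → InBag W t₀ b × InBag W t₁ b → ¬ Adj G a b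
  separator-nonadjacent {t₀} {t₁} {a} {b} t₀t₁ within (a₀ , a₁) (b₀ , b₁) ab =
    incompatible (piece-separation (branch? t₁) sep) (proj₂ inner) (proj₂ outer)
                 (⇔-both-false separated-inner separated-outer)
    where
      open Rooted T t₀
      sep : Separates (Branch t₁) a b
      sep = branch-separates t₀ within

      inner : ColouringOf (Piece (Branch t₁))
      inner = colour-piece sep root-in-no-branch

      outer : ColouringOf (Piece (∁ (Branch t₁)))
      outer = colour-co-piece sep (branch-of-neighbour t₀t₁)

      -- a and b lie in both parts, so both colourings separate them
      separated-inner : proj₁ inner a ≢ proj₁ inner b
      separated-inner = proj₂ inner a b ab (t₁ , branch-of-neighbour t₀t₁ , a₁)
                                           (t₁ , branch-of-neighbour t₀t₁ , b₁)
      separated-outer : proj₁ outer a ≢ proj₁ outer b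
      separated-outer = proj₂ outer a b ab (t₀ , root-in-no-branch , a₀) (t₀ , root-in-no-branch , b₀)

  separators-differ : ∀ {t₀ t₁ t₂ a b} → TAdj T t₀ t₁ → TAdj T t₀ t₂ → t₁ ≢ t₂ →
                      SharedWithin t₀ t₁ a b → SharedWithin t₀ t₂ a b → ⊥
  separators-differ {t₀} {t₁} {t₂} {a} {b} t₀t₁ t₀t₂ t₁≢t₂ within₁ within₂ =
    [ outer-pair , [ first-with-third , second-with-third ]′ ]′
      (two-of-three (cA a ≟ cA b) (cB a ≟ cB b) (cC a ≟ cC b))
    where
      open Rooted T t₀
      sep₁ : Separates (Branch t₁) a b
      sep₁ = branch-separates t₀ within₁

      sep₂ : Separates (Branch t₂) a b
      sep₂ = branch-separates t₀ within₂

      sep₁₂ : Separates (Branch t₁ ∪ Branch t₂) a b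
      sep₁₂ = separates-∪ sep₁ sep₂

      split₁ : Separation (Piece (Branch t₁)) (Piece (∁ (Branch t₁))) a b
      split₁ = piece-separation (branch? t₁) sep₁

      split₁₂ : Separation (Piece (Branch t₁ ∪ Branch t₂)) (Piece (∁ (Branch t₁ ∪ Branch t₂))) a b
      split₁₂ = piece-separation (branch? t₁ ∪? branch? t₂) sep₁₂

      colA : ColouringOf (Piece (Branch t₁ ∪ Branch t₂))
      colA = colour-piece sep₁₂ [ root-in-no-branch , root-in-no-branch ]′

      colB : ColouringOf (Piece (∁ (Branch t₂)))
      colB = colour-co-piece sep₂ (branch-of-neighbour t₀t₂)

      colC : ColouringOf (Piece (∁ (Branch t₁)))
      colC = colour-co-piece sep₁ (branch-of-neighbour t₀t₁)

      cA cB cC : Fin n → Fin (k ∸ 1)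
      cA = proj₁ colA
      cB = proj₁ colB
      cC = proj₁ colC

      branch₁-not-branch₂ : Branch t₁ ⊆ ∁ (Branch t₂)
      branch₁-not-branch₂ B₁ B₂ = t₁≢t₂ (Maybe.just-injective (trans (≡.sym B₁) B₂))

      -- each pair of colourings covers one of the two separations

      outer-pair : ¬ (cA a ≡ cA b ⇔ cB a ≡ cB b)
      outer-pair = incompatible split₁₂ (proj₂ colA)
        (proper-mono (piece-mono (λ ¬B₁₂ B₂ → ¬B₁₂ (inj₂ B₂))) (proj₂ colB))
      first-with-third : ¬ (cA a ≡ cA b ⇔ cC a ≡ cC b)
      first-with-third = incompatible split₁ (proper-mono (piece-mono inj₁) (proj₂ colA)) (proj₂ colC)
      second-with-third : ¬ (cB a ≡ cB b ⇔ cC a ≡ cC b)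
      second-with-third = incompatible split₁ (proper-mono (piece-mono branch₁-not-branch₂) (proj₂ colB))
                                       (proj₂ colC)

pair-nonadjacent : ∀ {n} (G : Graph n) {a b u v} → ¬ Adj G a b →
                   u ≡ a ⊎ u ≡ b → v ≡ a ⊎ v ≡ b → ¬ Adj G u v
pair-nonadjacent G ¬ab (inj₁ refl) (inj₁ refl) = irrefl G
pair-nonadjacent G ¬ab (inj₁ refl) (inj₂ refl) = ¬ab
pair-nonadjacent G ¬ab (inj₂ refl) (inj₁ refl) = ¬ab ∘ sym G
pair-nonadjacent G ¬ab (inj₂ refl) (inj₂ refl) = irrefl G

-- If W_{t₀} ∩ W_{t₁} and W_{t₀} ∩ W_{t₂} agree, membership moves from W_{t₂} to W_{t₁}.
∧-transfer : ∀ {p q r} → p ≡ true → (p ∧ q) ≡ (p ∧ r) → r ≡ true → q ≡ true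
∧-transfer refl q≡r r≡true = trans q≡r r≡true

lemma3p3 : (k : ℕ) → 4 ≤ k →
    {n : ℕ} (G : Graph n) → Critical k G →
    {m : ℕ} (T : Tree m) (W : Fin m → Fin n → Bool) → IsStandard G T W →
    ((t₀ t₁ : Fin m) → TAdj T t₀ t₁ →
       (u v : Fin n) → InBag W t₀ u → InBag W t₁ u → InBag W t₀ v → InBag W t₁ v →
       ¬ Adj G u v)
    ×
    ((t₀ t₁ t₂ : Fin m) → TAdj T t₀ t₁ → TAdj T t₀ t₂ → t₁ ≢ t₂ →
       ¬ ((v : Fin n) → (W t₀ v ∧ W t₁ v) ≡ (W t₀ v ∧ W t₂ v)))
lemma3p3 k _ G crit T W std = part-i , part-ii
  where
    open StandardCritical {k = k} crit std

    part-i : ∀ t₀ t₁ → TAdj T t₀ t₁ → ∀ u v → InBag W t₀ u → InBag W t₁ u →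
             InBag W t₀ v → InBag W t₁ v → ¬ Adj G u v
    part-i t₀ t₁ t₀t₁ u v u₀ u₁ v₀ v₁ with adhesion-pair t₀t₁
    ... | a , b , within , a∈ , b∈ =
      pair-nonadjacent G (separator-nonadjacent t₀t₁ within a∈ b∈) (within u₀ u₁) (within v₀ v₁)

    part-ii : ∀ t₀ t₁ t₂ → TAdj T t₀ t₁ → TAdj T t₀ t₂ → t₁ ≢ t₂ →
              ¬ (∀ v → (W t₀ v ∧ W t₁ v) ≡ (W t₀ v ∧ W t₂ v))
    part-ii t₀ t₁ t₂ t₀t₁ t₀t₂ t₁≢t₂ same-adhesion with adhesion-pair t₀t₁
    ... | a , b , within , _ =
      separators-differ t₀t₁ t₀t₂ t₁≢t₂ within
        (λ x₀ x₂ → within x₀ (∧-transfer x₀ (same-adhesion _) x₂))
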